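{- Let $h\ge0$ and let $\rho,\rho'$ be $h$-prefix bisimilar (w.r.t. $\mathsf{spec}$) traces of $K$. Then for every $\mathsf{A}\overline{\mathsf{A}}\mathsf{B}\overline{\mathsf{B}}\overline{\mathsf{E}}$ formula $\psi$ whose atomic formulas are in $\mathsf{spec}$ and with $\mathrm{depth}_B(\psi)\le h$, $K,\rho\models\psi$ iff $K,\rho'\models\psi$.
   Context: $K=(AP,S,R,\mu,s_0)$ is a Kripke structure over a finite set $AP$. A trace is a nonempty finite word $\rho$ over $S$ with $(\rho(i),\rho(i+1))\in R$ for all $i<|\rho|$; $\mu(\rho)=\mu(\rho(1))\cdots\mu(\rho(|\rho|))$; $\mathrm{Pref}(\rho)$ and $\mathrm{Suff}(\rho)$ are the sets of proper nonempty prefixes and suffixes of $\rho$. $\mathsf{spec}=\{r_1,\dots,r_H\}$ is a finite set of regular expressions over $AP$ ($r::=\varepsilon\mid\phi\mid r\cup r\mid r\cdot r\mid r^*$, $\phi$ propositional over $AP$, denoting languages over $2^{AP}$). For each $\ell$, $\mathcal A_\ell$ is the canonical complete NFA over alphabet $2^{AP}$ with state set $Q_\ell$ accepting $\mathcal L(r_\ell)$, state sets pairwise disjoint. Summary: $\mathcal S(\rho)=(\rho(1),\Pi,\rho(|\rho|))$ where $\Pi$ is the set of pairs $(q,q')$ with $q,q'\in Q_\ell$ for some $\ell$ such that some run of $\mathcal A_\ell$ over $\mu(\rho)$ goes from $q$ to $q'$. $\rho,\rho'$ are $0$-prefix bisimilar iff $\mathcal S(\rho)=\mathcal S(\rho')$;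 for $h>0$, $h$-prefix bisimilar iff $\mathcal S(\rho)=\mathcal S(\rho')$ and each proper prefix of either one has a proper prefix of the other that is $(h-1)$-prefix bisimilar to it. $\mathsf{A}\overline{\mathsf{A}}\mathsf{B}\overline{\mathsf{B}}\overline{\mathsf{E}}$ formulas: $\psi::=r\mid\neg\psi\mid\psi\wedge\psi\mid\langle X\rangle\psi$, $X\in\{A,\overline A,B,\overline B,\overline E\}$, with $K,\rho\models r$ iff $\mu(\rho)\in\mathcal L(r)$; $\langle B\rangle\psi$ iff $\psi$ holds on some $\rho'\in\mathrm{Pref}(\rho)$; $\langle\overline B\rangle\psi$ (resp. $\langle\overline E\rangle\psi$) iff $\psi$ holds on some trace $\rho'$ of $K$ with $\rho\in\mathrm{Pref}(\rho')$ (resp. $\rho\in\mathrm{Suff}(\rho')$); $\langle A\rangle\psi$ (resp. $\langle\overline A\rangle\psi$) iff $\psi$ holds on some trace $\rho'$ with $\rho'(1)=\rho(|\rho|)$ (resp. $\rho'(|\rho'|)=\rho(1)$). $\mathrm{depth}_B$: $0$ on REs, unchanged by $\neg$, max for $\wedge$, $+1$ for $\langle B\rangle$, unchanged by $\langle X\rangle$ for $X\in\{A,\overline A,\overline B,\overline E\}$. -}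

module Defs where

open import Data.Nat using (ℕ; zero; suc; _⊔_)
open import Data.Fin using (Fin)
open import Data.Fin.Subset using (Subset; _∈_)
open import Data.List using (List; []; _∷_; _++_; map)
open import Data.List.NonEmpty using (List⁺; _∷_; toList; head; last)
open import Data.Product using (Σ; _×_; _,_; ∃)
open import Data.Sum using (_⊎_)
open import Data.Unit using (⊤)
open import Data.Empty using (⊥)
open import Relation.Nullary using (¬_)
open import Relation.Binary.PropositionalEquality using (_≡_)

Letter : ℕ → Set
Letter n = Subset n

Word : ℕ → Set
Word n = List (Letter n)

data PropF (n : ℕ) : Set where
  atom : Fin n → PropF n
  tt   : PropF n
  not  : PropF n → PropF n
  and  : PropF n → PropF n → PropF n
  or   : PropF n → PropF n → PropF n

_⊨p_ : ∀ {n} → Letter n → PropF n → Set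
σ ⊨p atom p  = p ∈ σ
σ ⊨p tt      = ⊤
σ ⊨p not φ   = ¬ (σ ⊨p φ)
σ ⊨p and φ χ = (σ ⊨p φ) × (σ ⊨p χ)
σ ⊨p or φ χ  = (σ ⊨p φ) ⊎ (σ ⊨p χ)

data RE (n : ℕ) : Set where
  eps  : RE n
  prop : PropF n → RE n
  _∪ʳ_ : RE n → RE n → RE n
  _·ʳ_ : RE n → RE n → RE n
  _*ʳ  : RE n → RE n

data _∈L_ {n : ℕ} : Word n → RE n → Set where
  eps   : [] ∈L eps
  prop  : ∀ {σ φ} → σ ⊨p φ → (σ ∷ []) ∈L prop φ
  unionˡ : ∀ {w r s} → w ∈L r → w ∈L (r ∪ʳ s)
  unionʳ : ∀ {w r s} → w ∈L s → w ∈L (r ∪ʳ s)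
  concat : ∀ {u v r s} → u ∈L r → v ∈L s → (u ++ v) ∈L (r ·ʳ s)
  star0  : ∀ {r} → [] ∈L (r *ʳ)
  starS  : ∀ {u v r} → u ∈L r → v ∈L (r *ʳ) → (u ++ v) ∈L (r *ʳ)

record NFA (n : ℕ) : Set₁ where
  field
    Q     : Set
    δ     : Q → Letter n → Q → Set
    Init  : Q → Set
    Final : Q → Set

data Run {n : ℕ} (A : NFA n) : NFA.Q A → Word n → NFA.Q A → Set where
  done : ∀ {q} → Run A q [] q
  step : ∀ {q q₁ q' σ w} → NFA.δ A q σ q₁ → Run A q₁ w q' → Run A q (σ ∷ w) q'

Complete : ∀ {n} → NFA n → Set
Complete A = ∀ q σ → Σ (NFA.Q A) λ q' → NFA.δ A q σ q'

Accepts : ∀ {n} → NFA n → Word n → Set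
Accepts A w = Σ (NFA.Q A) λ q → Σ (NFA.Q A) λ q' →
  NFA.Init A q × NFA.Final A q' × Run A q w q'

record Kripke (n : ℕ) : Set₁ where
  field
    S  : Set
    R  : S → S → Set
    μ  : S → Letter n
    s₀ : S

module _ {n : ℕ} (K : Kripke n) where
  open Kripke K

  Consecutive : List S → Set
  Consecutive []           = ⊤
  Consecutive (s ∷ [])     = ⊤
  Consecutive (s ∷ t ∷ xs) = R s t × Consecutive (t ∷ xs)

  IsTrace : List⁺ S → Set
  IsTrace ρ = Consecutive (toList ρ)

  μ* : List⁺ S → Word n
  μ* ρ = map μ (toList ρ)

ProperPrefix : ∀ {S : Set} → List⁺ S → List⁺ S → Set
ProperPrefix {S} ρ' ρ = Σ (List⁺ S) λ σ → toList ρ ≡ toList ρ' ++ toList σ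

ProperSuffix : ∀ {S : Set} → List⁺ S → List⁺ S → Set
ProperSuffix {S} ρ' ρ = Σ (List⁺ S) λ σ → toList ρ ≡ toList σ ++ toList ρ'

-- The pairwise disjointness of the state sets is modelled by indexing
-- pairs (q,q') with ℓ, i.e. by the disjoint union Σ ℓ (Q_ℓ × Q_ℓ).

module _ {n H : ℕ} (K : Kripke n) (A : Fin H → NFA n) where
  open Kripke K

  InΠ : List⁺ S → (ℓ : Fin H) → NFA.Q (A ℓ) → NFA.Q (A ℓ) → Set
  InΠ ρ ℓ q q' = Run (A ℓ) q (μ* K ρ) q'

  SameSummary : List⁺ S → List⁺ S → Set
  SameSummary ρ ρ' =
    (head ρ ≡ head ρ') × (last ρ ≡ last ρ') ×
    (∀ ℓ q q' → (InΠ ρ ℓ q q' → InΠ ρ' ℓ q q') × (InΠ ρ' ℓ q q' → InΠ ρ ℓ q q'))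

  PrefixBisim : ℕ → List⁺ S → List⁺ S → Set
  PrefixBisim zero    ρ ρ' = SameSummary ρ ρ'
  PrefixBisim (suc h) ρ ρ' =
    SameSummary ρ ρ' ×
    (∀ σ → ProperPrefix σ ρ → Σ (List⁺ S) λ σ' → ProperPrefix σ' ρ' × PrefixBisim h σ σ') ×
    (∀ σ' → ProperPrefix σ' ρ' → Σ (List⁺ S) λ σ → ProperPrefix σ ρ × PrefixBisim h σ' σ)

-- A Ā B B̄ Ē formulas whose atoms are in spec (atoms are indices ℓ of spec)

data Mod : Set where
  A Ā B̄ Ē : Mod

data Form (H : ℕ) : Set where
  atom : Fin H → Form H
  ¬f   : Form H → Form H
  _∧f_ : Form H → Form H → Form H
  ⟨B⟩  : Form H → Form H
  ⟨_⟩  : Mod → Form H → Form H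

depthB : ∀ {H} → Form H → ℕ
depthB (atom _)  = 0
depthB (¬f ψ)    = depthB ψ
depthB (ψ ∧f χ)  = depthB ψ ⊔ depthB χ
depthB (⟨B⟩ ψ)   = suc (depthB ψ)
depthB (⟨ _ ⟩ ψ) = depthB ψ

module _ {n H : ℕ} (K : Kripke n) (spec : Fin H → RE n) where
  open Kripke K

  Sat : List⁺ S → Form H → Set
  Sat ρ (atom ℓ)  = μ* K ρ ∈L spec ℓ
  Sat ρ (¬f ψ)    = ¬ Sat ρ ψ
  Sat ρ (ψ ∧f χ)  = Sat ρ ψ × Sat ρ χ
  Sat ρ (⟨B⟩ ψ)   = Σ (List⁺ S) λ ρ' → ProperPrefix ρ' ρ × Sat ρ' ψ
  Sat ρ (⟨ B̄ ⟩ ψ) = Σ (List⁺ S) λ ρ' → IsTrace K ρ' × ProperPrefix ρ ρ' × Sat ρ' ψ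
  Sat ρ (⟨ Ē ⟩ ψ) = Σ (List⁺ S) λ ρ' → IsTrace K ρ' × ProperSuffix ρ ρ' × Sat ρ' ψ
  Sat ρ (⟨ A ⟩ ψ) = Σ (List⁺ S) λ ρ' → IsTrace K ρ' × (head ρ' ≡ last ρ) × Sat ρ' ψ
  Sat ρ (⟨ Ā ⟩ ψ) = Σ (List⁺ S) λ ρ' → IsTrace K ρ' × (last ρ' ≡ head ρ) × Sat ρ' ψ

-- Every modality except ⟨B⟩ only inspects the endpoints of the current trace, or
-- moves to a trace obtained by concatenating a fixed trace on the left or on the
-- right; ⟨B⟩ moves to a proper prefix and consumes one level of bisimilarity.
-- Atoms only see the summary, since an automaton accepts a word iff some run
-- from an initial to a final state exists. So everything reduces to the fact that
-- h-prefix bisimilarity is a congruence for concatenation: the runs over a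
-- concatenation are composites of runs over the parts, and a proper prefix of
-- a ⁺++⁺ b is a proper prefix of a, a itself, or a extended by a proper prefix
-- of b.
module Submission where

open import Defs
open import Data.Nat using (ℕ; _≤_; zero; suc; s≤s)
open import Data.Nat.Properties using (m⊔n≤o⇒m≤o; m⊔n≤o⇒n≤o)
open import Data.Fin using (Fin)
open import Data.List using (List; []; _∷_; _++_; initLast; _∷ʳ′_)
open import Data.List.Properties using (∷-injective; map-++; ++-assoc; ++-identityʳ)
open import Data.List.NonEmpty using (List⁺; _∷_; tail; _⁺++⁺_; toList; head; last)
open import Data.List.NonEmpty.Properties using (∷→∷⁺)
open import Data.Product using (Σ; ∃; _×_; _,_; proj₁; proj₂; swap)
open import Data.Sum using (_⊎_; inj₁; inj₂)
open import Relation.Binary.PropositionalEquality using (_≡_; refl; sym; trans; cong; subst)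

levi : ∀ {A : Set} (as bs cs ds : List A) → as ++ bs ≡ cs ++ ds →
  (∃ λ m → as ≡ cs ++ m × ds ≡ m ++ bs) ⊎ (∃ λ m → cs ≡ as ++ m × bs ≡ m ++ ds)
levi []       bs cs       ds e    = inj₂ (cs , refl , e)
levi (a ∷ as) bs []       ds e    = inj₁ (a ∷ as , refl , sym e)
levi (a ∷ as) bs (c ∷ cs) ds e with ∷-injective e
... | refl , e′ with levi as bs cs ds e′
... | inj₁ (m , as≡cs++m , ds≡m++bs) = inj₁ (m , cong (a ∷_) as≡cs++m , ds≡m++bs)
... | inj₂ (m , cs≡as++m , bs≡m++ds) = inj₂ (m , cong (a ∷_) cs≡as++m , bs≡m++ds)

module _ {A : Set} where

  toList-injective : {a b : List⁺ A} → toList a ≡ toList b → a ≡ b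
  toList-injective = ∷→∷⁺

  last-∷ : ∀ (x y : A) ys → last (x ∷ y ∷ ys) ≡ last (y ∷ ys)
  last-∷ x y ys with initLast ys
  ... | [] = refl
  ... | zs ∷ʳ′ z = refl

  last-⁺++⁺ : ∀ (a b : List⁺ A) → last (a ⁺++⁺ b) ≡ last b
  last-⁺++⁺ (x ∷ xs) b = last-∷-++ x xs
    where
    last-∷-++ : ∀ x xs → last (x ∷ (xs ++ toList b)) ≡ last b
    last-∷-++ x []       = last-∷ x (head b) (tail b)
    last-∷-++ x (z ∷ zs) = trans (last-∷ x z (zs ++ toList b)) (last-∷-++ z zs)

  ProperPrefix-⁺++⁺ : (a b : List⁺ A) → ProperPrefix a (a ⁺++⁺ b)
  ProperPrefix-⁺++⁺ a b = b , refl

  ProperPrefix-⁺++⁺ʳ : ∀ {τ a} (b : List⁺ A) → ProperPrefix τ a → ProperPrefix τ (a ⁺++⁺ b)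
  ProperPrefix-⁺++⁺ʳ {τ} b (κ , a≡τ++κ) =
    κ ⁺++⁺ b , trans (cong (_++ toList b) a≡τ++κ) (++-assoc (toList τ) (toList κ) (toList b))

  ProperPrefix-⁺++⁺ˡ : ∀ {τ b} (a : List⁺ A) → ProperPrefix τ b → ProperPrefix (a ⁺++⁺ τ) (a ⁺++⁺ b)
  ProperPrefix-⁺++⁺ˡ {τ} a (κ , b≡τ++κ) =
    κ , trans (cong (toList a ++_) b≡τ++κ) (sym (++-assoc (toList a) (toList τ) (toList κ)))

  ProperPrefix-⁺++⁺⁻ : ∀ {τ} (a b : List⁺ A) → ProperPrefix τ (a ⁺++⁺ b) →
    ProperPrefix τ a ⊎ τ ≡ a ⊎ ∃ λ m → ProperPrefix m b × τ ≡ a ⁺++⁺ m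
  ProperPrefix-⁺++⁺⁻ {τ} a b (κ , e) with levi (toList a) (toList b) (toList τ) (toList κ) e
  ... | inj₁ ([]    , a≡τ++[] , _) =
    inj₂ (inj₁ (toList-injective (sym (trans a≡τ++[] (++-identityʳ (toList τ))))))
  ... | inj₁ (x ∷ m , a≡τ++m  , _) = inj₁ (x ∷ m , a≡τ++m)
  ... | inj₂ ([]    , τ≡a++[] , _) =
    inj₂ (inj₁ (toList-injective (trans τ≡a++[] (++-identityʳ (toList a)))))
  ... | inj₂ (x ∷ m , τ≡a++m  , b≡m++κ) = inj₂ (inj₂ (x ∷ m , (κ , b≡m++κ) , toList-injective τ≡a++m))

module _ {n : ℕ} {𝒜 : NFA n} where

  Run-++⁻ : ∀ {q q'} u v → Run 𝒜 q (u ++ v) q' → ∃ λ m → Run 𝒜 q u m × Run 𝒜 m v q'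
  Run-++⁻ []      v r          = _ , done , r
  Run-++⁻ (σ ∷ u) v (step d r) with Run-++⁻ u v r
  ... | m , r₁ , r₂ = m , step d r₁ , r₂

  Run-++⁺ : ∀ {q m q' u v} → Run 𝒜 q u m → Run 𝒜 m v q' → Run 𝒜 q (u ++ v) q'
  Run-++⁺ done         r₂ = r₂
  Run-++⁺ (step d r₁) r₂ = step d (Run-++⁺ r₁ r₂)

module _ {n : ℕ} (K : Kripke n) where
  open Kripke K

  IsTrace-⁺++⁺⁻ : ∀ a b → IsTrace K (a ⁺++⁺ b) → IsTrace K a × R (last a) (head b) × IsTrace K b
  IsTrace-⁺++⁺⁻ (x ∷ xs) b = split x xs
    where
    split : ∀ x xs → IsTrace K ((x ∷ xs) ⁺++⁺ b) →
      IsTrace K (x ∷ xs) × R (last (x ∷ xs)) (head b) × IsTrace K b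
    split x []       (r , tb) = _ , r , tb
    split x (y ∷ ys) (r , t) with split y ys t
    ... | ta , r′ , tb = (r , ta) , subst (λ s → R s (head b)) (sym (last-∷ x y ys)) r′ , tb

  IsTrace-⁺++⁺⁺ : ∀ a b → IsTrace K a → R (last a) (head b) → IsTrace K b → IsTrace K (a ⁺++⁺ b)
  IsTrace-⁺++⁺⁺ (x ∷ xs) b = join x xs
    where
    join : ∀ x xs → IsTrace K (x ∷ xs) → R (last (x ∷ xs)) (head b) → IsTrace K b →
      IsTrace K ((x ∷ xs) ⁺++⁺ b)
    join x []       _        r tb = r , tb
    join x (y ∷ ys) (r , ta) r′ tb = r , join y ys ta (subst (λ s → R s (head b)) (last-∷ x y ys) r′) tb

  IsTrace-prefix : ∀ {τ ρ} → ProperPrefix τ ρ → IsTrace K ρ → IsTrace K τ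
  IsTrace-prefix {τ} (κ , ρ≡τ++κ) t = proj₁ (IsTrace-⁺++⁺⁻ τ κ (subst (Consecutive K) ρ≡τ++κ t))

module _ {n H : ℕ} (K : Kripke n) (𝒜 : Fin H → NFA n) where
  open Kripke K

  SamePairs : List⁺ S → List⁺ S → Set
  SamePairs ρ ρ' = ∀ ℓ q q' → (InΠ K 𝒜 ρ ℓ q q' → InΠ K 𝒜 ρ' ℓ q q') × (InΠ K 𝒜 ρ' ℓ q q' → InΠ K 𝒜 ρ ℓ q q')

  InΠ-⁺++⁺ : ∀ {a a' b b' ℓ q q'} → SamePairs a a' → SamePairs b b' →
    InΠ K 𝒜 (a ⁺++⁺ b) ℓ q q' → InΠ K 𝒜 (a' ⁺++⁺ b') ℓ q q'
  InΠ-⁺++⁺ {a} {a'} {b} {b'} {ℓ} {q} {q'} a≈a' b≈b' r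
    with Run-++⁻ (μ* K a) (μ* K b) (subst (λ w → Run (𝒜 ℓ) q w q') (map-++ μ (toList a) (toList b)) r)
  ... | m , ra , rb = subst (λ w → Run (𝒜 ℓ) q w q') (sym (map-++ μ (toList a') (toList b')))
                        (Run-++⁺ (proj₁ (a≈a' ℓ q m) ra) (proj₁ (b≈b' ℓ m q') rb))

  SamePairs-sym : ∀ {ρ ρ'} → SamePairs ρ ρ' → SamePairs ρ' ρ
  SamePairs-sym ρ≈ρ' ℓ q q' = swap (ρ≈ρ' ℓ q q')

  SamePairs-⁺++⁺ : ∀ {a a' b b'} → SamePairs a a' → SamePairs b b' → SamePairs (a ⁺++⁺ b) (a' ⁺++⁺ b')
  SamePairs-⁺++⁺ a≈a' b≈b' ℓ q q' =
    InΠ-⁺++⁺ a≈a' b≈b' , InΠ-⁺++⁺ (SamePairs-sym a≈a') (SamePairs-sym b≈b')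

  SameSummary-sym : ∀ {ρ ρ'} → SameSummary K 𝒜 ρ ρ' → SameSummary K 𝒜 ρ' ρ
  SameSummary-sym (h≡ , l≡ , ρ≈ρ') = sym h≡ , sym l≡ , SamePairs-sym ρ≈ρ'

  SameSummary-⁺++⁺ : ∀ {a a' b b'} → SameSummary K 𝒜 a a' → SameSummary K 𝒜 b b' →
    SameSummary K 𝒜 (a ⁺++⁺ b) (a' ⁺++⁺ b')
  SameSummary-⁺++⁺ {a} {a'} {b} {b'} (h≡ , _ , a≈a') (_ , l≡ , b≈b') =
    h≡ , trans (last-⁺++⁺ a b) (trans l≡ (sym (last-⁺++⁺ a' b'))) , SamePairs-⁺++⁺ a≈a' b≈b'

  PrefixBisim⇒SameSummary : ∀ h {ρ ρ'} → PrefixBisim K 𝒜 h ρ ρ' → SameSummary K 𝒜 ρ ρ'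
  PrefixBisim⇒SameSummary zero    s           = s
  PrefixBisim⇒SameSummary (suc h) (s , _ , _) = s

  PrefixBisim⇒head≡ : ∀ h {ρ ρ'} → PrefixBisim K 𝒜 h ρ ρ' → head ρ ≡ head ρ'
  PrefixBisim⇒head≡ h b = proj₁ (PrefixBisim⇒SameSummary h b)

  PrefixBisim⇒last≡ : ∀ h {ρ ρ'} → PrefixBisim K 𝒜 h ρ ρ' → last ρ ≡ last ρ'
  PrefixBisim⇒last≡ h b = proj₁ (proj₂ (PrefixBisim⇒SameSummary h b))

  PrefixBisim⇒SamePairs : ∀ h {ρ ρ'} → PrefixBisim K 𝒜 h ρ ρ' → SamePairs ρ ρ'
  PrefixBisim⇒SamePairs h b = proj₂ (proj₂ (PrefixBisim⇒SameSummary h b))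

  PrefixBisim-refl : ∀ h ρ → PrefixBisim K 𝒜 h ρ ρ
  PrefixBisim-refl zero    ρ = refl , refl , λ ℓ q q' → (λ r → r) , (λ r → r)
  PrefixBisim-refl (suc h) ρ =
    PrefixBisim-refl zero ρ , (λ τ p → τ , p , PrefixBisim-refl h τ) , (λ τ p → τ , p , PrefixBisim-refl h τ)

  PrefixBisim-sym : ∀ h {ρ ρ'} → PrefixBisim K 𝒜 h ρ ρ' → PrefixBisim K 𝒜 h ρ' ρ
  PrefixBisim-sym zero    s           = SameSummary-sym s
  PrefixBisim-sym (suc h) (s , f , g) = SameSummary-sym s , g , f

  PrefixBisim-suc⇒ : ∀ h {ρ ρ'} → PrefixBisim K 𝒜 (suc h) ρ ρ' → PrefixBisim K 𝒜 h ρ ρ'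
  PrefixBisim-suc⇒ zero    (s , _ , _) = s
  PrefixBisim-suc⇒ (suc h) (s , f , g) = s , weaken f , weaken g
    where
    weaken : ∀ {ρ ρ'} →
      (∀ τ → ProperPrefix τ ρ → Σ (List⁺ S) λ τ' → ProperPrefix τ' ρ' × PrefixBisim K 𝒜 (suc h) τ τ') →
      (∀ τ → ProperPrefix τ ρ → Σ (List⁺ S) λ τ' → ProperPrefix τ' ρ' × PrefixBisim K 𝒜 h τ τ')
    weaken f τ p with f τ p
    ... | τ' , p' , b = τ' , p' , PrefixBisim-suc⇒ h b

  PrefixBisim-⁺++⁺ : ∀ h {a a' b b'} → PrefixBisim K 𝒜 h a a' → PrefixBisim K 𝒜 h b b' →
    PrefixBisim K 𝒜 h (a ⁺++⁺ b) (a' ⁺++⁺ b')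
  PrefixBisim-⁺++⁺ zero    sa sb = SameSummary-⁺++⁺ sa sb
  PrefixBisim-⁺++⁺ (suc h) ba@(sa , _) bb@(sb , _) =
    SameSummary-⁺++⁺ sa sb ,
    matchPrefix ba bb ,
    matchPrefix (PrefixBisim-sym (suc h) ba) (PrefixBisim-sym (suc h) bb)
    where
    matchPrefix : ∀ {a a' b b'} → PrefixBisim K 𝒜 (suc h) a a' → PrefixBisim K 𝒜 (suc h) b b' →
      ∀ τ → ProperPrefix τ (a ⁺++⁺ b) →
      Σ (List⁺ S) λ τ' → ProperPrefix τ' (a' ⁺++⁺ b') × PrefixBisim K 𝒜 h τ τ'
    matchPrefix {a} {a'} {b} {b'} (_ , fa , _) _ τ p with ProperPrefix-⁺++⁺⁻ a b p
    ... | inj₁ τ<a with fa τ τ<a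
    ...   | τ' , τ'<a' , τ∼τ' = τ' , ProperPrefix-⁺++⁺ʳ b' τ'<a' , τ∼τ'
    matchPrefix {a} {a'} {b} {b'} ba _ τ p | inj₂ (inj₁ refl) =
      a' , ProperPrefix-⁺++⁺ a' b' , PrefixBisim-suc⇒ h ba
    matchPrefix {a} {a'} {b} {b'} ba (_ , fb , _) τ p | inj₂ (inj₂ (m , m<b , refl)) with fb m m<b
    ... | m' , m'<b' , m∼m' =
      a' ⁺++⁺ m' , ProperPrefix-⁺++⁺ˡ a' m'<b' , PrefixBisim-⁺++⁺ h (PrefixBisim-suc⇒ h ba) m∼m'

  PrefixBisim-extendʳ : ∀ h {ρ ρ' ρ''} → IsTrace K ρ' → PrefixBisim K 𝒜 h ρ ρ' →
    IsTrace K ρ'' → ProperPrefix ρ ρ'' →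
    Σ (List⁺ S) λ ρ''' → IsTrace K ρ''' × ProperPrefix ρ' ρ''' × PrefixBisim K 𝒜 h ρ'' ρ'''
  PrefixBisim-extendʳ h {ρ} {ρ'} t' b t'' (σ , e) with toList-injective {b = ρ ⁺++⁺ σ} e
  ... | refl with IsTrace-⁺++⁺⁻ K ρ σ t''
  ...   | _ , r , tσ =
    ρ' ⁺++⁺ σ ,
    IsTrace-⁺++⁺⁺ K ρ' σ t' (subst (λ s → R s (head σ)) (PrefixBisim⇒last≡ h b) r) tσ ,
    ProperPrefix-⁺++⁺ ρ' σ ,
    PrefixBisim-⁺++⁺ h b (PrefixBisim-refl h σ)

  PrefixBisim-extendˡ : ∀ h {ρ ρ' ρ''} → IsTrace K ρ' → PrefixBisim K 𝒜 h ρ ρ' →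
    IsTrace K ρ'' → ProperSuffix ρ ρ'' →
    Σ (List⁺ S) λ ρ''' → IsTrace K ρ''' × ProperSuffix ρ' ρ''' × PrefixBisim K 𝒜 h ρ'' ρ'''
  PrefixBisim-extendˡ h {ρ} {ρ'} t' b t'' (σ , e) with toList-injective {b = σ ⁺++⁺ ρ} e
  ... | refl with IsTrace-⁺++⁺⁻ K σ ρ t''
  ...   | tσ , r , _ =
    σ ⁺++⁺ ρ' ,
    IsTrace-⁺++⁺⁺ K σ ρ' tσ (subst (R (last σ)) (PrefixBisim⇒head≡ h b) r) t' ,
    (σ , refl) ,
    PrefixBisim-⁺++⁺ h (PrefixBisim-refl h σ) b

module _ {n H : ℕ} (K : Kripke n) (spec : Fin H → RE n) (𝒜 : Fin H → NFA n)
  (recognises : ∀ ℓ w → (w ∈L spec ℓ → Accepts (𝒜 ℓ) w) × (Accepts (𝒜 ℓ) w → w ∈L spec ℓ)) where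

  ∈L-resp-SamePairs : ∀ {ρ ρ' ℓ} → SamePairs K 𝒜 ρ ρ' → μ* K ρ ∈L spec ℓ → μ* K ρ' ∈L spec ℓ
  ∈L-resp-SamePairs {ρ} {ρ'} {ℓ} ρ≈ρ' w∈L with proj₁ (recognises ℓ (μ* K ρ)) w∈L
  ... | q , q' , i , f , r = proj₂ (recognises ℓ (μ* K ρ')) (q , q' , i , f , proj₁ (ρ≈ρ' ℓ q q') r)

  Sat-resp-PrefixBisim : ∀ h {ρ ρ'} → IsTrace K ρ → IsTrace K ρ' → PrefixBisim K 𝒜 h ρ ρ' →
    ∀ ψ → depthB ψ ≤ h → Sat K spec ρ ψ → Sat K spec ρ' ψ
  Sat-resp-PrefixBisim h t t' b (atom ℓ) d s = ∈L-resp-SamePairs (PrefixBisim⇒SamePairs K 𝒜 h b) s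
  Sat-resp-PrefixBisim h t t' b (¬f ψ) d s =
    λ s' → s (Sat-resp-PrefixBisim h t' t (PrefixBisim-sym K 𝒜 h b) ψ d s')
  Sat-resp-PrefixBisim h t t' b (ψ ∧f χ) d (sψ , sχ) =
    Sat-resp-PrefixBisim h t t' b ψ (m⊔n≤o⇒m≤o (depthB ψ) (depthB χ) d) sψ ,
    Sat-resp-PrefixBisim h t t' b χ (m⊔n≤o⇒n≤o (depthB ψ) (depthB χ) d) sχ
  Sat-resp-PrefixBisim (suc h) t t' (_ , f , _) (⟨B⟩ ψ) (s≤s d) (τ , τ<ρ , s) with f τ τ<ρ
  ... | τ' , τ'<ρ' , τ∼τ' =
    τ' , τ'<ρ' , Sat-resp-PrefixBisim h (IsTrace-prefix K τ<ρ t) (IsTrace-prefix K τ'<ρ' t') τ∼τ' ψ d s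
  Sat-resp-PrefixBisim h t t' b (⟨ A ⟩ ψ) d (ρ'' , t'' , e , s) =
    ρ'' , t'' , trans e (PrefixBisim⇒last≡ K 𝒜 h b) , s
  Sat-resp-PrefixBisim h t t' b (⟨ Ā ⟩ ψ) d (ρ'' , t'' , e , s) =
    ρ'' , t'' , trans e (PrefixBisim⇒head≡ K 𝒜 h b) , s
  Sat-resp-PrefixBisim h t t' b (⟨ B̄ ⟩ ψ) d (ρ'' , t'' , p , s) with PrefixBisim-extendʳ K 𝒜 h t' b t'' p
  ... | ρ''' , t''' , p' , b' = ρ''' , t''' , p' , Sat-resp-PrefixBisim h t'' t''' b' ψ d s
  Sat-resp-PrefixBisim h t t' b (⟨ Ē ⟩ ψ) d (ρ'' , t'' , p , s) with PrefixBisim-extendˡ K 𝒜 h t' b t'' p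
  ... | ρ''' , t''' , p' , b' = ρ''' , t''' , p' , Sat-resp-PrefixBisim h t'' t''' b' ψ d s

proposition3 : {n H : ℕ} (K : Kripke n) (spec : Fin H → RE n)
    (𝒜 : Fin H → NFA n)
    → (∀ ℓ → Complete (𝒜 ℓ))
    → (∀ ℓ w → (w ∈L spec ℓ → Accepts (𝒜 ℓ) w) × (Accepts (𝒜 ℓ) w → w ∈L spec ℓ))
    → (h : ℕ) (ρ ρ' : List⁺ (Kripke.S K))
    → IsTrace K ρ → IsTrace K ρ'
    → PrefixBisim K 𝒜 h ρ ρ'
    → (ψ : Form H) → depthB ψ ≤ h
    → (Sat K spec ρ ψ → Sat K spec ρ' ψ) × (Sat K spec ρ' ψ → Sat K spec ρ ψ)
proposition3 K spec 𝒜 _ recognises h ρ ρ' t t' b ψ d =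
  Sat-resp-PrefixBisim K spec 𝒜 recognises h t t' b ψ d ,
  Sat-resp-PrefixBisim K spec 𝒜 recognises h t' t (PrefixBisim-sym K 𝒜 h b) ψ d
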